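{- For every formula $\phi$ there is (effectively computable from $\phi$) a formula $\psi$ in disjunctive normal form such that $\vdash_{\mathbf{MP}^*}\phi\leftrightarrow\psi$.
   Context: Formulas: built from a countable set $\mathsf{A}$ of atomic formulas (containing $\top,\bot$) by $\land,\neg,\Box,\mathsf{K}$; $\Diamond\phi:=\neg\Box\neg\phi$, $\mathsf{L}\phi:=\neg\mathsf{K}\neg\phi$. $\mathcal{L}'$ is the least set of formulas containing $\mathsf{A}$ and closed under $\land$, $\neg$ and $\phi\mapsto\Diamond\mathsf{K}\phi$. A formula is in prime normal form if it has the form $\psi\land\mathsf{K}\psi'\land\bigwedge_{i=1}^n\mathsf{L}\psi_i$ with $\psi,\psi',\psi_i\in\mathcal{L}'$ and $n$ finite; it is in disjunctive normal form if it is a finite disjunction of formulas in prime normal form. The system $\mathbf{MP}^*$ has rules modus ponens, $\mathsf{K}$-necessitation, $\Box$-necessitation and axioms all instances of: (1) propositional tautologies; (2) $(A\to\Box A)\land(\neg A\to\Box\neg A)$ for atomic $A$; (3) $\Box(\phi\to\psi)\to(\Box\phi\to\Box\psi)$; (4) $\Box\phi\to\phi$; (5) $\Box\phi\to\Box\Box\phi$; (6) $\mathsf{K}(\phi\to\psi)\to(\mathsf{K}\phi\to\mathsf{K}\psi)$; (7) $\mathsf{K}\phi\to\phi$; (8) $\mathsf{K}\phi\to\mathsf{K}\mathsf{K}\phi$; (9) $\phi\to\mathsf{K}\mathsf{L}\phi$; (10) $\mathsf{K}\Box\phi\to\Box\mathsf{K}\phi$; (11) $\Diamond\Box\phi\to\Box\Diamond\phi$;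 (12) $\Diamond(\mathsf{K}\phi\land\psi)\land\mathsf{L}\Diamond(\mathsf{K}\phi\land\chi)\to\Diamond(\mathsf{K}\Diamond\phi\land\Diamond\psi\land\mathsf{L}\Diamond\chi)$. -}

module Defs where

open import Data.Nat using (ℕ)
open import Data.Bool using (Bool; true; false; not; _∧_)
open import Relation.Binary.PropositionalEquality using (_≡_)

data Atom : Set where
  top : Atom
  bot : Atom
  var : ℕ → Atom

infixr 6 _∧'_
infixr 5 _∨'_
infixr 4 _⇒_
infix 3 _⇔_
infix 8 ¬'_ □_ K_ ◇_ L_
infix 1 ⊢_
data Formula : Set where
  atom : Atom → Formula
  _∧'_ : Formula → Formula → Formula
  ¬'_  : Formula → Formula
  □_   : Formula → Formula
  K_   : Formula → Formula

⊤' ⊥' : Formula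
⊤' = atom top
⊥' = atom bot

◇_ : Formula → Formula
◇ φ = ¬' (□ (¬' φ))

L_ : Formula → Formula
L φ = ¬' (K (¬' φ))

_∨'_ : Formula → Formula → Formula
φ ∨' ψ = ¬' ((¬' φ) ∧' (¬' ψ))

_⇒_ : Formula → Formula → Formula
φ ⇒ ψ = ¬' (φ ∧' (¬' ψ))

_⇔_ : Formula → Formula → Formula
φ ⇔ ψ = (φ ⇒ ψ) ∧' (ψ ⇒ φ)

-- Propositional tautologies: the propositional skeleton (atoms other than
-- ⊤/⊥ and formulas □φ, Kφ treated as propositional letters; ⊤ true, ⊥ false)
-- is true under every valuation.
eval : (Formula → Bool) → Formula → Bool
eval v (atom top) = true
eval v (atom bot) = false
eval v (atom (var n)) = v (atom (var n))
eval v (φ ∧' ψ) = eval v φ ∧ eval v ψ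
eval v (¬' φ) = not (eval v φ)
eval v (□ φ) = v (□ φ)
eval v (K φ) = v (K φ)

Tautology : Formula → Set
Tautology φ = (v : Formula → Bool) → eval v φ ≡ true

data ⊢_ : Formula → Set where
  ax1  : ∀ {φ} → Tautology φ → ⊢ φ
  ax2  : ∀ a → ⊢ ((atom a ⇒ □ atom a) ∧' (¬' atom a ⇒ □ (¬' atom a)))
  ax3  : ∀ φ ψ → ⊢ (□ (φ ⇒ ψ) ⇒ (□ φ ⇒ □ ψ))
  ax4  : ∀ φ → ⊢ (□ φ ⇒ φ)
  ax5  : ∀ φ → ⊢ (□ φ ⇒ □ □ φ)
  ax6  : ∀ φ ψ → ⊢ (K (φ ⇒ ψ) ⇒ (K φ ⇒ K ψ))
  ax7  : ∀ φ → ⊢ (K φ ⇒ φ)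
  ax8  : ∀ φ → ⊢ (K φ ⇒ K K φ)
  ax9  : ∀ φ → ⊢ (φ ⇒ K L φ)
  ax10 : ∀ φ → ⊢ (K □ φ ⇒ □ K φ)
  ax11 : ∀ φ → ⊢ (◇ □ φ ⇒ □ ◇ φ)
  ax12 : ∀ φ ψ χ →
    ⊢ (((◇ (K φ ∧' ψ)) ∧' (L ◇ (K φ ∧' χ)))
        ⇒ ◇ ((K ◇ φ) ∧' ((◇ ψ) ∧' (L ◇ χ))))
  mp    : ∀ {φ ψ} → ⊢ (φ ⇒ ψ) → ⊢ φ → ⊢ ψ
  K-nec : ∀ {φ} → ⊢ φ → ⊢ (K φ)
  □-nec : ∀ {φ} → ⊢ φ → ⊢ (□ φ)

data InL' : Formula → Set where
  atomL : ∀ a → InL' (atom a)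
  andL  : ∀ {φ ψ} → InL' φ → InL' ψ → InL' (φ ∧' ψ)
  negL  : ∀ {φ} → InL' φ → InL' (¬' φ)
  ◇KL   : ∀ {φ} → InL' φ → InL' (◇ (K φ))

data PNF : Formula → Set where
  base : ∀ {ψ ψ'} → InL' ψ → InL' ψ' → PNF (ψ ∧' K ψ')
  addL : ∀ {φ χ} → PNF φ → InL' χ → PNF (φ ∧' L χ)

data DNF : Formula → Set where
  single : ∀ {φ} → PNF φ → DNF φ
  orD    : ∀ {φ χ} → DNF φ → PNF χ → DNF (φ ∨' χ)

-- Formulas of L′ are rigid: A → □A and ¬A → □¬A (axioms 2, 5, 10, 11).
-- Disjunctions of primes ψ ∧ Kψ′ ∧ ⋀ᵢ Lψᵢ are closed under ∧ (distributivity and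
-- K(A ∧ B) ↔ KA ∧ KB) and under ¬ (De Morgan, with ¬Kψ′ ↔ L¬ψ′); since □ = ¬◇¬ and
-- K = ¬L¬ it remains to close them under ◇ and L, which distribute over ∨.  In S5 the
-- part Kψ′ ∧ ⋀ᵢ Lψᵢ of a prime is K-stable, so L of the prime is Kψ′ ∧ ⋀ᵢ Lψᵢ ∧ Lψ.
-- The rigid ψ leaves a ◇, and ◇(Kψ′ ∧ ⋀ᵢ Lψᵢ) ↔ ◇Kψ′ ∧ ⋀ᵢ L(◇Kψ′ ∧ ψᵢ) is proved one
-- conjunct at a time, left to right with axiom 10 and right to left with axiom 12.

module Submission where

open import Defs
open import Data.Bool using (Bool; true; false; not; _∧_; T)
open import Data.Bool.Properties using (T-∧; T-≡)
open import Data.Fin using (Fin; #_)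
open import Data.List using (List; []; _∷_; _++_; map; foldl; cartesianProductWith)
open import Data.List.Relation.Unary.All using (All; []; _∷_)
import Data.List.Relation.Unary.All as All
open import Data.List.Relation.Unary.All.Properties using (++⁺; map⁺)
open import Data.Nat using (ℕ; zero; suc; _<?_)
open import Data.Product using (Σ; _×_; _,_; proj₁; proj₂)
open import Data.Vec using (Vec; []; _∷_; lookup)
import Data.Vec as Vec
open import Data.Vec.Properties using (lookup-map)
open import Function using (_∘_; Equivalence)
open import Level using (0ℓ)
open import Relation.Binary.Bundles using (Preorder)
open import Relation.Binary.PropositionalEquality using (_≡_; refl)
import Relation.Binary.PropositionalEquality as ≡
open import Relation.Nullary.Decidable using (True)

infixr 6 _∧ₛ_
infixr 5 _∨ₛ_
infixr 4 _⇒ₛ_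
infix 3 _⇔ₛ_
infix 8 ¬ₛ_

data Schema (n : ℕ) : Set where
  var     : Fin n → Schema n
  ⊤ₛ ⊥ₛ   : Schema n
  _∧ₛ_    : Schema n → Schema n → Schema n
  ¬ₛ_     : Schema n → Schema n

private variable
  n : ℕ

#ₛ_ : ∀ m {m<n : True (m <? n)} → Schema n
#ₛ_ m {m<n} = var (#_ m {m<n = m<n})

_∨ₛ_ _⇒ₛ_ _⇔ₛ_ : Schema n → Schema n → Schema n
s ∨ₛ t = ¬ₛ (¬ₛ s ∧ₛ ¬ₛ t)
s ⇒ₛ t = ¬ₛ (s ∧ₛ ¬ₛ t)
s ⇔ₛ t = (s ⇒ₛ t) ∧ₛ (t ⇒ₛ s)

_[_] : Schema n → Vec Formula n → Formula
var i   [ σ ] = lookup σ i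
⊤ₛ      [ σ ] = ⊤'
⊥ₛ      [ σ ] = ⊥'
(s ∧ₛ t) [ σ ] = s [ σ ] ∧' t [ σ ]
(¬ₛ s)  [ σ ] = ¬' s [ σ ]

⟦_⟧ₛ : Schema n → Vec Bool n → Bool
⟦ var i ⟧ₛ  ρ = lookup ρ i
⟦ ⊤ₛ ⟧ₛ     ρ = true
⟦ ⊥ₛ ⟧ₛ     ρ = false
⟦ s ∧ₛ t ⟧ₛ ρ = ⟦ s ⟧ₛ ρ ∧ ⟦ t ⟧ₛ ρ
⟦ ¬ₛ s ⟧ₛ   ρ = not (⟦ s ⟧ₛ ρ)

eval-[] : ∀ v (s : Schema n) σ → eval v (s [ σ ]) ≡ ⟦ s ⟧ₛ (Vec.map (eval v) σ)
eval-[] v (var i)  σ = ≡.sym (lookup-map i (eval v) σ)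
eval-[] v ⊤ₛ       σ = refl
eval-[] v ⊥ₛ       σ = refl
eval-[] v (s ∧ₛ t) σ = ≡.cong₂ _∧_ (eval-[] v s σ) (eval-[] v t σ)
eval-[] v (¬ₛ s)   σ = ≡.cong not (eval-[] v s σ)

allValuations : ∀ n → (Vec Bool n → Bool) → Bool
allValuations zero    f = f []
allValuations (suc n) f = allValuations n (f ∘ (true ∷_)) ∧ allValuations n (f ∘ (false ∷_))

allValuations-sound : ∀ n f → T (allValuations n f) → ∀ ρ → T (f ρ)
allValuations-sound zero    f valid [] = valid
allValuations-sound (suc n) f valid (true ∷ ρ) =
  allValuations-sound n _ (proj₁ (Equivalence.to T-∧ valid)) ρ
allValuations-sound (suc n) f valid (false ∷ ρ) =
  allValuations-sound n _ (proj₂ (Equivalence.to (T-∧ {allValuations n (f ∘ (true ∷_))}) valid)) ρ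

tautology : (s : Schema n) (σ : Vec Formula n) → {T (allValuations n ⟦ s ⟧ₛ)} → ⊢ s [ σ ]
tautology {n} s σ {valid} = ax1 λ v →
  ≡.trans (eval-[] v s σ) (Equivalence.to T-≡ (allValuations-sound n ⟦ s ⟧ₛ valid (Vec.map (eval v) σ)))

private variable
  A B C D R A′ B′ : Formula
  cs : List Formula

mp₂ : ⊢ A ⇒ B ⇒ C → ⊢ A → ⊢ B → ⊢ C
mp₂ h a b = mp (mp h a) b

mp₃ : ⊢ A ⇒ B ⇒ C ⇒ D → ⊢ A → ⊢ B → ⊢ C → ⊢ D
mp₃ h a b c = mp (mp₂ h a b) c

⇒-refl : ⊢ A ⇒ A
⇒-refl {A} = tautology (#ₛ 0 ⇒ₛ #ₛ 0) (A ∷ [])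

⇒-trans : ⊢ A ⇒ B → ⊢ B ⇒ C → ⊢ A ⇒ C
⇒-trans {A} {B} {C} = mp₂ (tautology ((#ₛ 0 ⇒ₛ #ₛ 1) ⇒ₛ (#ₛ 1 ⇒ₛ #ₛ 2) ⇒ₛ (#ₛ 0 ⇒ₛ #ₛ 2)) (A ∷ B ∷ C ∷ []))

⇔-intro : ⊢ A ⇒ B → ⊢ B ⇒ A → ⊢ A ⇔ B
⇔-intro {A} {B} = mp₂ (tautology ((#ₛ 0 ⇒ₛ #ₛ 1) ⇒ₛ (#ₛ 1 ⇒ₛ #ₛ 0) ⇒ₛ (#ₛ 0 ⇔ₛ #ₛ 1)) (A ∷ B ∷ []))

⇔-to : ⊢ A ⇔ B → ⊢ A ⇒ B
⇔-to {A} {B} = mp (tautology ((#ₛ 0 ⇔ₛ #ₛ 1) ⇒ₛ (#ₛ 0 ⇒ₛ #ₛ 1)) (A ∷ B ∷ []))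

⇔-from : ⊢ A ⇔ B → ⊢ B ⇒ A
⇔-from {A} {B} = mp (tautology ((#ₛ 0 ⇔ₛ #ₛ 1) ⇒ₛ (#ₛ 1 ⇒ₛ #ₛ 0)) (A ∷ B ∷ []))

⇔-refl : ⊢ A ⇔ A
⇔-refl = ⇔-intro ⇒-refl ⇒-refl

⇔-sym : ⊢ A ⇔ B → ⊢ B ⇔ A
⇔-sym h = ⇔-intro (⇔-from h) (⇔-to h)

⇔-trans : ⊢ A ⇔ B → ⊢ B ⇔ C → ⊢ A ⇔ C
⇔-trans h g = ⇔-intro (⇒-trans (⇔-to h) (⇔-to g)) (⇒-trans (⇔-from g) (⇔-from h))

⊢-preorder : Preorder 0ℓ 0ℓ 0ℓ
⊢-preorder = record
  { Carrier    = Formula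
  ; _≈_        = λ A B → ⊢ A ⇔ B
  ; _≲_        = λ A B → ⊢ A ⇒ B
  ; isPreorder = record
    { isEquivalence = record { refl = ⇔-refl ; sym = ⇔-sym ; trans = ⇔-trans }
    ; reflexive     = ⇔-to
    ; trans         = ⇒-trans
    }
  }

open import Relation.Binary.Reasoning.Preorder ⊢-preorder

contraposition : ⊢ A ⇒ B → ⊢ ¬' B ⇒ ¬' A
contraposition {A} {B} = mp (tautology ((#ₛ 0 ⇒ₛ #ₛ 1) ⇒ₛ (¬ₛ #ₛ 1 ⇒ₛ ¬ₛ #ₛ 0)) (A ∷ B ∷ []))

¬-cong : ⊢ A ⇔ B → ⊢ ¬' A ⇔ ¬' B
¬-cong h = ⇔-intro (contraposition (⇔-from h)) (contraposition (⇔-to h))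

∧-mono : ⊢ A ⇒ A′ → ⊢ B ⇒ B′ → ⊢ A ∧' B ⇒ A′ ∧' B′
∧-mono {A} {A′} {B} {B′} = mp₂ (tautology
  ((#ₛ 0 ⇒ₛ #ₛ 1) ⇒ₛ (#ₛ 2 ⇒ₛ #ₛ 3) ⇒ₛ (#ₛ 0 ∧ₛ #ₛ 2 ⇒ₛ #ₛ 1 ∧ₛ #ₛ 3)) (A ∷ A′ ∷ B ∷ B′ ∷ []))

∧-cong : ⊢ A ⇔ A′ → ⊢ B ⇔ B′ → ⊢ A ∧' B ⇔ A′ ∧' B′
∧-cong h g = ⇔-intro (∧-mono (⇔-to h) (⇔-to g)) (∧-mono (⇔-from h) (⇔-from g))

∨-cong : ⊢ A ⇔ A′ → ⊢ B ⇔ B′ → ⊢ A ∨' B ⇔ A′ ∨' B′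
∨-cong h g = ¬-cong (∧-cong (¬-cong h) (¬-cong g))

⇒-∧ : ⊢ A ⇒ B → ⊢ A ⇒ C → ⊢ A ⇒ B ∧' C
⇒-∧ {A} {B} {C} = mp₂ (tautology
  ((#ₛ 0 ⇒ₛ #ₛ 1) ⇒ₛ (#ₛ 0 ⇒ₛ #ₛ 2) ⇒ₛ (#ₛ 0 ⇒ₛ #ₛ 1 ∧ₛ #ₛ 2)) (A ∷ B ∷ C ∷ []))

∧-elimˡ : ⊢ A ∧' B ⇒ A
∧-elimˡ {A} {B} = tautology (#ₛ 0 ∧ₛ #ₛ 1 ⇒ₛ #ₛ 0) (A ∷ B ∷ [])

∧-elimʳ : ⊢ A ∧' B ⇒ B
∧-elimʳ {A} {B} = tautology (#ₛ 0 ∧ₛ #ₛ 1 ⇒ₛ #ₛ 1) (A ∷ B ∷ [])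

∧-comm : ⊢ A ∧' B ⇒ B ∧' A
∧-comm = ⇒-∧ ∧-elimʳ ∧-elimˡ

¬¬-equiv : ⊢ ¬' ¬' A ⇔ A
¬¬-equiv {A} = tautology (¬ₛ ¬ₛ #ₛ 0 ⇔ₛ #ₛ 0) (A ∷ [])

record Normal (M : Formula → Formula) : Set where
  field
    necessitation : ∀ {φ} → ⊢ φ → ⊢ M φ
    distribution  : ∀ φ ψ → ⊢ M (φ ⇒ ψ) ⇒ (M φ ⇒ M ψ)

module Normal-Properties {M : Formula → Formula} (normal : Normal M) where
  open Normal normal

  ◆ : Formula → Formula
  ◆ φ = ¬' M (¬' φ)

  mono : ⊢ A ⇒ B → ⊢ M A ⇒ M B
  mono h = mp (distribution _ _) (necessitation h)

  cong : ⊢ A ⇔ B → ⊢ M A ⇔ M B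
  cong h = ⇔-intro (mono (⇔-to h)) (mono (⇔-from h))

  ◆-mono : ⊢ A ⇒ B → ⊢ ◆ A ⇒ ◆ B
  ◆-mono h = contraposition (mono (contraposition h))

  ◆-cong : ⊢ A ⇔ B → ⊢ ◆ A ⇔ ◆ B
  ◆-cong h = ⇔-intro (◆-mono (⇔-to h)) (◆-mono (⇔-from h))

  ¬◆¬ : ⊢ ¬' ◆ (¬' A) ⇔ M A
  ¬◆¬ = ⇔-trans ¬¬-equiv (cong ¬¬-equiv)

  M-∧ : ⊢ M (A ∧' B) ⇔ M A ∧' M B
  M-∧ {A} {B} = ⇔-intro (⇒-∧ (mono ∧-elimˡ) (mono ∧-elimʳ)) (mp₂ (tautology
    ((#ₛ 0 ⇒ₛ #ₛ 2) ⇒ₛ (#ₛ 2 ⇒ₛ #ₛ 1 ⇒ₛ #ₛ 3) ⇒ₛ (#ₛ 0 ∧ₛ #ₛ 1 ⇒ₛ #ₛ 3))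
    (M A ∷ M B ∷ M (B ⇒ A ∧' B) ∷ M (A ∧' B) ∷ []))
    (mono (tautology (#ₛ 0 ⇒ₛ #ₛ 1 ⇒ₛ #ₛ 0 ∧ₛ #ₛ 1) (A ∷ B ∷ [])))
    (distribution B (A ∧' B)))

  M-◆-∧ : ⊢ M A ∧' ◆ B ⇒ ◆ (A ∧' B)
  M-◆-∧ {A} {B} = mp (tautology
    ((#ₛ 0 ⇒ₛ #ₛ 1 ⇒ₛ #ₛ 2) ⇒ₛ (#ₛ 0 ∧ₛ ¬ₛ #ₛ 2 ⇒ₛ ¬ₛ #ₛ 1))
    (M A ∷ M (¬' (A ∧' B)) ∷ M (¬' B) ∷ []))
    (⇒-trans (mono (tautology (#ₛ 0 ⇒ₛ ¬ₛ (#ₛ 0 ∧ₛ #ₛ 1) ⇒ₛ ¬ₛ #ₛ 1) (A ∷ B ∷ [])))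
             (distribution (¬' (A ∧' B)) (¬' B)))

  ◆-∧ : ⊢ ◆ (A ∧' B) ⇒ ◆ A ∧' ◆ B
  ◆-∧ = ⇒-∧ (◆-mono ∧-elimˡ) (◆-mono ∧-elimʳ)

  ◆-∨ : ⊢ ◆ (A ∨' B) ⇔ ◆ A ∨' ◆ B
  ◆-∨ {A} {B} = begin-equality
    ◆ (A ∨' B)                    ≈⟨ ¬-cong (cong ¬¬-equiv) ⟩
    ¬' M (¬' A ∧' ¬' B)           ≈⟨ ¬-cong M-∧ ⟩
    ¬' (M (¬' A) ∧' M (¬' B))     ≈⟨ ¬-cong (∧-cong ¬¬-equiv ¬¬-equiv) ⟨
    ◆ A ∨' ◆ B                    ∎

  ◆-⊥ : ⊢ ◆ ⊥' ⇔ ⊥'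
  ◆-⊥ = mp (tautology (#ₛ 0 ⇒ₛ (¬ₛ #ₛ 0 ⇔ₛ ⊥ₛ)) (M (¬' ⊥') ∷ []))
           (necessitation (tautology (¬ₛ ⊥ₛ) []))

  ◆-elim : ⊢ ¬' A ⇒ M (¬' A) → ⊢ ◆ A ⇒ A
  ◆-elim h = ⇒-trans (contraposition h) (⇔-to ¬¬-equiv)

  ¬¬-preserves-⇒M : ⊢ A ⇒ M A → ⊢ ¬' ¬' A ⇒ M (¬' ¬' A)
  ¬¬-preserves-⇒M h = ⇒-trans (⇔-to ¬¬-equiv) (⇒-trans h (mono (⇔-from ¬¬-equiv)))

  Stable : Formula → Set
  Stable A = (⊢ A ⇒ M A) × (⊢ ¬' A ⇒ M (¬' A))

  ⊤-stable : Stable ⊤'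
  ⊤-stable = mp (tautology (#ₛ 0 ⇒ₛ ⊤ₛ ⇒ₛ #ₛ 0) (M ⊤' ∷ [])) (necessitation (tautology ⊤ₛ [])) ,
             tautology (¬ₛ ⊤ₛ ⇒ₛ #ₛ 0) (M (¬' ⊤') ∷ [])

  ∧-stable : Stable A → Stable B → Stable (A ∧' B)
  ∧-stable {A} {B} (A↑ , ¬A↑) (B↑ , ¬B↑) =
    ⇒-trans (∧-mono A↑ B↑) (⇔-from M-∧) ,
    mp₂ (tautology ((¬ₛ #ₛ 0 ⇒ₛ #ₛ 2) ⇒ₛ (¬ₛ #ₛ 1 ⇒ₛ #ₛ 2) ⇒ₛ (¬ₛ (#ₛ 0 ∧ₛ #ₛ 1) ⇒ₛ #ₛ 2))
                    (A ∷ B ∷ M (¬' (A ∧' B)) ∷ []))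
        (⇒-trans ¬A↑ (mono (contraposition ∧-elimˡ)))
        (⇒-trans ¬B↑ (mono (contraposition ∧-elimʳ)))

  ¬-stable : Stable A → Stable (¬' A)
  ¬-stable (A↑ , ¬A↑) = ¬A↑ , ¬¬-preserves-⇒M A↑

  ◆-∧-stable : Stable A → ⊢ ◆ (A ∧' B) ⇔ A ∧' ◆ B
  ◆-∧-stable (A↑ , ¬A↑) = ⇔-intro (⇒-trans ◆-∧ (∧-mono (◆-elim ¬A↑) ⇒-refl))
                                  (⇒-trans (∧-mono A↑ ⇒-refl) M-◆-∧)

  ⇒M-⇒-M⇒ : ⊢ ¬' A ⇒ M (¬' A) → ⊢ (A ⇒ M B) ⇒ M (A ⇒ B)
  ⇒M-⇒-M⇒ {A} {B} ¬A↑ = mp₂ (tautology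
    ((#ₛ 1 ⇒ₛ #ₛ 2) ⇒ₛ (¬ₛ #ₛ 0 ⇒ₛ #ₛ 2) ⇒ₛ ((#ₛ 0 ⇒ₛ #ₛ 1) ⇒ₛ #ₛ 2))
    (A ∷ M B ∷ M (A ⇒ B) ∷ []))
    (mono (tautology (#ₛ 1 ⇒ₛ (#ₛ 0 ⇒ₛ #ₛ 1)) (A ∷ B ∷ [])))
    (⇒-trans ¬A↑ (mono (tautology (¬ₛ #ₛ 0 ⇒ₛ (#ₛ 0 ⇒ₛ #ₛ 1)) (A ∷ B ∷ []))))

□-normal : Normal □_
□-normal = record { necessitation = □-nec ; distribution = ax3 }

K-normal : Normal K_
K-normal = record { necessitation = K-nec ; distribution = ax6 }

module □ = Normal-Properties □-normal
module K = Normal-Properties K-normal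

⊢K⊤ : ⊢ K ⊤'
⊢K⊤ = K-nec (tautology ⊤ₛ [])

L⇒KL : ⊢ L A ⇒ K L A
L⇒KL {A} = ⇒-trans (ax9 (L A)) (K.mono LL⇒L)
  where
  LL⇒L : ⊢ L L A ⇒ L A
  LL⇒L = contraposition (⇒-trans (ax8 (¬' A)) (K.mono (⇔-from ¬¬-equiv)))

K-stable : K.Stable (K A)
K-stable {A} = ax8 A , (begin
  ¬' K A        ≈⟨ ¬-cong (K.cong ¬¬-equiv) ⟨
  L (¬' A)      ≲⟨ L⇒KL ⟩
  K L (¬' A)    ≈⟨ K.cong (¬-cong (K.cong ¬¬-equiv)) ⟩
  K ¬' K A      ∎)

L-stable : K.Stable (L A)
L-stable {A} = L⇒KL , K.¬¬-preserves-⇒M (ax8 (¬' A))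

⋀L : List Formula → Formula
⋀L []       = ⊤'
⋀L (c ∷ cs) = L c ∧' ⋀L cs

⋀L-stable : ∀ cs → K.Stable (⋀L cs)
⋀L-stable []       = K.⊤-stable
⋀L-stable (c ∷ cs) = K.∧-stable L-stable (⋀L-stable cs)

Rigid : Formula → Set
Rigid = □.Stable

K-preserves-⇒□ : ⊢ A ⇒ □ A → ⊢ K A ⇒ □ K A
K-preserves-⇒□ {A} A↑ = ⇒-trans (K.mono A↑) (ax10 A)

◇K-rigid : Rigid A → Rigid (◇ K A)
◇K-rigid {A} (A↑ , _) =
  ⇒-trans (□.◆-mono (K-preserves-⇒□ A↑)) (ax11 (K A)) ,
  □.¬¬-preserves-⇒M (ax5 (¬' K A))

L′-rigid : InL' A → Rigid A
L′-rigid (atomL a) = mp ∧-elimˡ (ax2 a) , mp ∧-elimʳ (ax2 a)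
L′-rigid (andL A∈ B∈) = □.∧-stable (L′-rigid A∈) (L′-rigid B∈)
L′-rigid (negL A∈) = □.¬-stable (L′-rigid A∈)
L′-rigid (◇KL A∈) = ◇K-rigid (L′-rigid A∈)

◇L-elim : ⊢ ¬' A ⇒ □ ¬' A → ⊢ ◇ L A ⇒ L A
◇L-elim ¬A↑ = □.◆-elim (□.¬¬-preserves-⇒M (K-preserves-⇒□ ¬A↑))

◇⋀L-elim : All Rigid cs → ⊢ ◇ ⋀L cs ⇒ ⋀L cs
◇⋀L-elim []                = tautology (#ₛ 0 ⇒ₛ ⊤ₛ) (◇ ⊤' ∷ [])
◇⋀L-elim ((_ , ¬c↑) ∷ rs) = ⇒-trans □.◆-∧ (∧-mono (◇L-elim ¬c↑) (◇⋀L-elim rs))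

◇[K∧L]⇒L[◇K∧] : ⊢ ¬' C ⇒ □ ¬' C → ⊢ ◇ (K A ∧' L C) ⇒ L (◇ K A ∧' C)
◇[K∧L]⇒L[◇K∧] {C} {A} ¬C↑ = contraposition (begin
  K ¬' (◇ K A ∧' C)          ≲⟨ K.mono (tautology (¬ₛ (¬ₛ #ₛ 0 ∧ₛ #ₛ 1) ⇒ₛ (#ₛ 1 ⇒ₛ #ₛ 0))
                                                  (□ ¬' K A ∷ C ∷ [])) ⟩
  K (C ⇒ □ ¬' K A)           ≲⟨ K.mono (□.⇒M-⇒-M⇒ ¬C↑) ⟩
  K □ (C ⇒ ¬' K A)           ≲⟨ ax10 _ ⟩
  □ K (C ⇒ ¬' K A)           ≲⟨ □.mono K[C⇒¬KA]⇒¬[KA∧LC] ⟩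
  □ ¬' (K A ∧' L C)          ∎)
  where
  K[C⇒¬KA]⇒¬[KA∧LC] : ⊢ K (C ⇒ ¬' K A) ⇒ ¬' (K A ∧' L C)
  K[C⇒¬KA]⇒¬[KA∧LC] = mp₂ (tautology
    ((#ₛ 0 ⇒ₛ #ₛ 2 ⇒ₛ #ₛ 3) ⇒ₛ (#ₛ 1 ⇒ₛ #ₛ 2) ⇒ₛ (#ₛ 0 ⇒ₛ ¬ₛ (#ₛ 1 ∧ₛ ¬ₛ #ₛ 3)))
    (K (C ⇒ ¬' K A) ∷ K A ∷ K K A ∷ K ¬' C ∷ []))
    (⇒-trans (K.mono (tautology ((#ₛ 0 ⇒ₛ ¬ₛ #ₛ 1) ⇒ₛ (#ₛ 1 ⇒ₛ ¬ₛ #ₛ 0)) (C ∷ K A ∷ [])))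
             (ax6 (K A) (¬' C)))
    (ax8 A)

◇[K∧L∧] : Rigid A → Rigid C → ⊢ ◇ R ⇒ R →
          ⊢ ◇ (K A ∧' (L C ∧' R)) ⇔ ◇ (K A ∧' R) ∧' L (◇ K A ∧' C)
◇[K∧L∧] {A} {C} {R} (_ , ¬A↑) rC@(_ , ¬C↑) ◇R⇒R = ⇔-intro (begin
  ◇ (K A ∧' (L C ∧' R))                ≲⟨ □.◆-mono (tautology
                                            (#ₛ 0 ∧ₛ (#ₛ 1 ∧ₛ #ₛ 2) ⇒ₛ (#ₛ 0 ∧ₛ #ₛ 1) ∧ₛ (#ₛ 0 ∧ₛ #ₛ 2))
                                            (K A ∷ L C ∷ R ∷ [])) ⟩
  ◇ ((K A ∧' L C) ∧' (K A ∧' R))       ≲⟨ □.◆-∧ ⟩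
  ◇ (K A ∧' L C) ∧' ◇ (K A ∧' R)       ≲⟨ ∧-mono (◇[K∧L]⇒L[◇K∧] ¬C↑) ⇒-refl ⟩
  L (◇ K A ∧' C) ∧' ◇ (K A ∧' R)       ≲⟨ ∧-comm ⟩
  ◇ (K A ∧' R) ∧' L (◇ K A ∧' C)       ∎) (begin
  ◇ (K A ∧' R) ∧' L (◇ K A ∧' C)       ≲⟨ ∧-mono ⇒-refl (K.◆-mono ◇KA∧C⇒◇[KA∧C]) ⟩
  ◇ (K A ∧' R) ∧' L ◇ (K A ∧' C)       ≲⟨ ax12 A R C ⟩
  ◇ (K ◇ A ∧' (◇ R ∧' L ◇ C))          ≲⟨ □.◆-mono (∧-mono (K.mono (□.◆-elim ¬A↑))
                                                   (∧-mono ◇R⇒R (K.◆-mono (□.◆-elim ¬C↑)))) ⟩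
  ◇ (K A ∧' (R ∧' L C))                ≲⟨ □.◆-mono (∧-mono ⇒-refl (∧-comm)) ⟩
  ◇ (K A ∧' (L C ∧' R))                ∎)
  where
  ◇KA∧C⇒◇[KA∧C] : ⊢ ◇ K A ∧' C ⇒ ◇ (K A ∧' C)
  ◇KA∧C⇒◇[KA∧C] = begin
    ◇ K A ∧' C        ≲⟨ ∧-comm ⟩
    C ∧' ◇ K A        ≈⟨ □.◆-∧-stable rC ⟨
    ◇ (C ∧' K A)      ≲⟨ □.◆-mono (∧-comm) ⟩
    ◇ (K A ∧' C)      ∎

◇[K∧⋀L] : Rigid A → All Rigid cs → ⊢ ◇ (K A ∧' ⋀L cs) ⇔ ◇ K A ∧' ⋀L (map (◇ K A ∧'_) cs)
◇[K∧⋀L] {A} rA [] = ⇔-trans (□.◆-cong (tautology (#ₛ 0 ∧ₛ ⊤ₛ ⇔ₛ #ₛ 0) (K A ∷ [])))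
                             (tautology (#ₛ 0 ⇔ₛ #ₛ 0 ∧ₛ ⊤ₛ) (◇ K A ∷ []))
◇[K∧⋀L] {A} {c ∷ cs} rA (rc ∷ rcs) = begin-equality
  ◇ (K A ∧' (L c ∧' ⋀L cs))                   ≈⟨ ◇[K∧L∧] rA rc (◇⋀L-elim rcs) ⟩
  ◇ (K A ∧' ⋀L cs) ∧' L (◇ K A ∧' c)          ≈⟨ ∧-cong (◇[K∧⋀L] rA rcs) ⇔-refl ⟩
  (◇ K A ∧' ⋀L cs′) ∧' L (◇ K A ∧' c)         ≈⟨ tautology ((#ₛ 0 ∧ₛ #ₛ 1) ∧ₛ #ₛ 2 ⇔ₛ #ₛ 0 ∧ₛ (#ₛ 2 ∧ₛ #ₛ 1))
                                                          (◇ K A ∷ ⋀L cs′ ∷ L (◇ K A ∧' c) ∷ []) ⟩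
  ◇ K A ∧' (L (◇ K A ∧' c) ∧' ⋀L cs′)         ∎
  where
  cs′ : List Formula
  cs′ = map (◇ K A ∧'_) cs

record Prime : Set where
  constructor prime
  field
    ψ ψ′ : Formula
    ψs   : List Formula
    ψ∈   : InL' ψ
    ψ′∈  : InL' ψ′
    ψs∈  : All InL' ψs

⟦_⟧ᵖ : Prime → Formula
⟦ prime ψ ψ′ ψs _ _ _ ⟧ᵖ = ψ ∧' (K ψ′ ∧' ⋀L ψs)

atomᵖ : Atom → Prime
atomᵖ a = prime (atom a) ⊤' [] (atomL a) (atomL top) []

⟦atomᵖ⟧ : ∀ a → ⊢ ⟦ atomᵖ a ⟧ᵖ ⇔ atom a
⟦atomᵖ⟧ a = mp (tautology (#ₛ 1 ⇒ₛ (#ₛ 0 ∧ₛ (#ₛ 1 ∧ₛ ⊤ₛ) ⇔ₛ #ₛ 0)) (atom a ∷ K ⊤' ∷ [])) ⊢K⊤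

_∧ᵖ_ : Prime → Prime → Prime
prime ψ ψ′ ψs ψ∈ ψ′∈ ψs∈ ∧ᵖ prime φ φ′ φs φ∈ φ′∈ φs∈ =
  prime (ψ ∧' φ) (ψ′ ∧' φ′) (ψs ++ φs) (andL ψ∈ φ∈) (andL ψ′∈ φ′∈) (++⁺ ψs∈ φs∈)

⋀L-++ : ∀ cs ds → ⊢ ⋀L (cs ++ ds) ⇔ ⋀L cs ∧' ⋀L ds
⋀L-++ []       ds = tautology (#ₛ 0 ⇔ₛ ⊤ₛ ∧ₛ #ₛ 0) (⋀L ds ∷ [])
⋀L-++ (c ∷ cs) ds = ⇔-trans (∧-cong ⇔-refl (⋀L-++ cs ds))
  (tautology (#ₛ 0 ∧ₛ (#ₛ 1 ∧ₛ #ₛ 2) ⇔ₛ (#ₛ 0 ∧ₛ #ₛ 1) ∧ₛ #ₛ 2) (L c ∷ ⋀L cs ∷ ⋀L ds ∷ []))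

⟦∧ᵖ⟧ : ∀ p q → ⊢ ⟦ p ∧ᵖ q ⟧ᵖ ⇔ ⟦ p ⟧ᵖ ∧' ⟦ q ⟧ᵖ
⟦∧ᵖ⟧ (prime ψ ψ′ ψs _ _ _) (prime φ φ′ φs _ _ _) = begin-equality
  (ψ ∧' φ) ∧' (K (ψ′ ∧' φ′) ∧' ⋀L (ψs ++ φs))        ≈⟨ ∧-cong ⇔-refl (∧-cong K.M-∧ (⋀L-++ ψs φs)) ⟩
  (ψ ∧' φ) ∧' ((K ψ′ ∧' K φ′) ∧' (⋀L ψs ∧' ⋀L φs))    ≈⟨ tautology
    ((#ₛ 0 ∧ₛ #ₛ 1) ∧ₛ ((#ₛ 2 ∧ₛ #ₛ 3) ∧ₛ (#ₛ 4 ∧ₛ #ₛ 5)) ⇔ₛ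
     (#ₛ 0 ∧ₛ (#ₛ 2 ∧ₛ #ₛ 4)) ∧ₛ (#ₛ 1 ∧ₛ (#ₛ 3 ∧ₛ #ₛ 5)))
    (ψ ∷ φ ∷ K ψ′ ∷ K φ′ ∷ ⋀L ψs ∷ ⋀L φs ∷ []) ⟩
  (ψ ∧' (K ψ′ ∧' ⋀L ψs)) ∧' (φ ∧' (K φ′ ∧' ⋀L φs))    ∎

◇ᵖ : Prime → Prime
◇ᵖ (prime ψ ψ′ ψs ψ∈ ψ′∈ ψs∈) =
  prime (ψ ∧' ◇ K ψ′) ⊤' (map (◇ K ψ′ ∧'_) ψs) (andL ψ∈ (◇KL ψ′∈)) (atomL top)
        (map⁺ (All.map (andL (◇KL ψ′∈)) ψs∈))

⟦◇ᵖ⟧ : ∀ p → ⊢ ⟦ ◇ᵖ p ⟧ᵖ ⇔ ◇ ⟦ p ⟧ᵖ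
⟦◇ᵖ⟧ (prime ψ ψ′ ψs ψ∈ ψ′∈ ψs∈) = begin-equality
  (ψ ∧' ◇ K ψ′) ∧' (K ⊤' ∧' ⋀L ψs′)     ≈⟨ mp (tautology
    (#ₛ 2 ⇒ₛ ((#ₛ 0 ∧ₛ #ₛ 1) ∧ₛ (#ₛ 2 ∧ₛ #ₛ 3) ⇔ₛ #ₛ 0 ∧ₛ (#ₛ 1 ∧ₛ #ₛ 3)))
    (ψ ∷ ◇ K ψ′ ∷ K ⊤' ∷ ⋀L ψs′ ∷ [])) ⊢K⊤ ⟩
  ψ ∧' (◇ K ψ′ ∧' ⋀L ψs′)               ≈⟨ ∧-cong ⇔-refl (◇[K∧⋀L] (L′-rigid ψ′∈) (All.map L′-rigid ψs∈)) ⟨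
  ψ ∧' ◇ (K ψ′ ∧' ⋀L ψs)                ≈⟨ □.◆-∧-stable (L′-rigid ψ∈) ⟨
  ◇ (ψ ∧' (K ψ′ ∧' ⋀L ψs))              ∎
  where
  ψs′ : List Formula
  ψs′ = map (◇ K ψ′ ∧'_) ψs

Lᵖ : Prime → Prime
Lᵖ (prime ψ ψ′ ψs ψ∈ ψ′∈ ψs∈) = prime ⊤' ψ′ (ψ ∷ ψs) (atomL top) ψ′∈ (ψ∈ ∷ ψs∈)

⟦Lᵖ⟧ : ∀ p → ⊢ ⟦ Lᵖ p ⟧ᵖ ⇔ L ⟦ p ⟧ᵖ
⟦Lᵖ⟧ (prime ψ ψ′ ψs _ _ _) = begin-equality
  ⊤' ∧' (K ψ′ ∧' (L ψ ∧' ⋀L ψs))    ≈⟨ tautology (⊤ₛ ∧ₛ (#ₛ 0 ∧ₛ (#ₛ 1 ∧ₛ #ₛ 2)) ⇔ₛ (#ₛ 0 ∧ₛ #ₛ 2) ∧ₛ #ₛ 1)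
                                                 (K ψ′ ∷ L ψ ∷ ⋀L ψs ∷ []) ⟩
  (K ψ′ ∧' ⋀L ψs) ∧' L ψ            ≈⟨ K.◆-∧-stable (K.∧-stable K-stable (⋀L-stable ψs)) ⟨
  L ((K ψ′ ∧' ⋀L ψs) ∧' ψ)          ≈⟨ K.◆-cong (tautology (#ₛ 0 ∧ₛ #ₛ 1 ⇔ₛ #ₛ 1 ∧ₛ #ₛ 0) (K ψ′ ∧' ⋀L ψs ∷ ψ ∷ [])) ⟩
  L (ψ ∧' (K ψ′ ∧' ⋀L ψs))          ∎

⟦_⟧ᵈ : List Prime → Formula
⟦ [] ⟧ᵈ     = ⊥'
⟦ p ∷ ps ⟧ᵈ = ⟦ p ⟧ᵖ ∨' ⟦ ps ⟧ᵈ

⟦++⟧ : ∀ ps qs → ⊢ ⟦ ps ++ qs ⟧ᵈ ⇔ ⟦ ps ⟧ᵈ ∨' ⟦ qs ⟧ᵈ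
⟦++⟧ []       qs = tautology (#ₛ 0 ⇔ₛ ⊥ₛ ∨ₛ #ₛ 0) (⟦ qs ⟧ᵈ ∷ [])
⟦++⟧ (p ∷ ps) qs = ⇔-trans (∨-cong ⇔-refl (⟦++⟧ ps qs))
  (tautology (#ₛ 0 ∨ₛ (#ₛ 1 ∨ₛ #ₛ 2) ⇔ₛ (#ₛ 0 ∨ₛ #ₛ 1) ∨ₛ #ₛ 2) (⟦ p ⟧ᵖ ∷ ⟦ ps ⟧ᵈ ∷ ⟦ qs ⟧ᵈ ∷ []))

⟦map⟧ : (F : Formula → Formula) → (∀ {A B} → ⊢ F (A ∨' B) ⇔ F A ∨' F B) → ⊢ F ⊥' ⇔ ⊥' →
        (f : Prime → Prime) → (∀ p → ⊢ ⟦ f p ⟧ᵖ ⇔ F ⟦ p ⟧ᵖ) →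
        ∀ ps → ⊢ ⟦ map f ps ⟧ᵈ ⇔ F ⟦ ps ⟧ᵈ
⟦map⟧ F F-∨ F-⊥ f ⟦f⟧ []       = ⇔-sym F-⊥
⟦map⟧ F F-∨ F-⊥ f ⟦f⟧ (p ∷ ps) = ⇔-trans (∨-cong (⟦f⟧ p) (⟦map⟧ F F-∨ F-⊥ f ⟦f⟧ ps)) (⇔-sym F-∨)

_∧ᵈ_ : List Prime → List Prime → List Prime
_∧ᵈ_ = cartesianProductWith _∧ᵖ_

⟦∧ᵈ⟧ : ∀ ps qs → ⊢ ⟦ ps ∧ᵈ qs ⟧ᵈ ⇔ ⟦ ps ⟧ᵈ ∧' ⟦ qs ⟧ᵈ
⟦∧ᵈ⟧ []       qs = tautology (⊥ₛ ⇔ₛ ⊥ₛ ∧ₛ #ₛ 0) (⟦ qs ⟧ᵈ ∷ [])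
⟦∧ᵈ⟧ (p ∷ ps) qs = begin-equality
  ⟦ map (p ∧ᵖ_) qs ++ ps ∧ᵈ qs ⟧ᵈ                     ≈⟨ ⟦++⟧ (map (p ∧ᵖ_) qs) (ps ∧ᵈ qs) ⟩
  ⟦ map (p ∧ᵖ_) qs ⟧ᵈ ∨' ⟦ ps ∧ᵈ qs ⟧ᵈ                ≈⟨ ∨-cong ⟦p∧ᵖqs⟧ (⟦∧ᵈ⟧ ps qs) ⟩
  (⟦ p ⟧ᵖ ∧' ⟦ qs ⟧ᵈ) ∨' (⟦ ps ⟧ᵈ ∧' ⟦ qs ⟧ᵈ)          ≈⟨ tautology
    ((#ₛ 0 ∧ₛ #ₛ 2) ∨ₛ (#ₛ 1 ∧ₛ #ₛ 2) ⇔ₛ (#ₛ 0 ∨ₛ #ₛ 1) ∧ₛ #ₛ 2) (⟦ p ⟧ᵖ ∷ ⟦ ps ⟧ᵈ ∷ ⟦ qs ⟧ᵈ ∷ []) ⟩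
  (⟦ p ⟧ᵖ ∨' ⟦ ps ⟧ᵈ) ∧' ⟦ qs ⟧ᵈ                      ∎
  where
  ⟦p∧ᵖqs⟧ : ⊢ ⟦ map (p ∧ᵖ_) qs ⟧ᵈ ⇔ ⟦ p ⟧ᵖ ∧' ⟦ qs ⟧ᵈ
  ⟦p∧ᵖqs⟧ = ⟦map⟧ (⟦ p ⟧ᵖ ∧'_)
    (λ {A} {B} → tautology (#ₛ 0 ∧ₛ (#ₛ 1 ∨ₛ #ₛ 2) ⇔ₛ (#ₛ 0 ∧ₛ #ₛ 1) ∨ₛ (#ₛ 0 ∧ₛ #ₛ 2)) (⟦ p ⟧ᵖ ∷ A ∷ B ∷ []))
    (tautology (#ₛ 0 ∧ₛ ⊥ₛ ⇔ₛ ⊥ₛ) (⟦ p ⟧ᵖ ∷ []))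
    (p ∧ᵖ_) (⟦∧ᵖ⟧ p) qs

Kᵖ : InL' A → Prime
Kᵖ {A} A∈ = prime ⊤' A [] (atomL top) A∈ []

¬⋀Lᵈ : All InL' cs → List Prime
¬⋀Lᵈ []         = []
¬⋀Lᵈ (c∈ ∷ cs∈) = Kᵖ (negL c∈) ∷ ¬⋀Lᵈ cs∈

⟦¬⋀Lᵈ⟧ : (cs∈ : All InL' cs) → ⊢ ⟦ ¬⋀Lᵈ cs∈ ⟧ᵈ ⇔ ¬' ⋀L cs
⟦¬⋀Lᵈ⟧ []                      = tautology (⊥ₛ ⇔ₛ ¬ₛ ⊤ₛ) []
⟦¬⋀Lᵈ⟧ (_∷_ {c} {cs} c∈ cs∈) = mp (tautology
  ((#ₛ 1 ⇔ₛ ¬ₛ #ₛ 2) ⇒ₛ ((⊤ₛ ∧ₛ (#ₛ 0 ∧ₛ ⊤ₛ)) ∨ₛ #ₛ 1 ⇔ₛ ¬ₛ (¬ₛ #ₛ 0 ∧ₛ #ₛ 2)))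
  (K ¬' c ∷ ⟦ ¬⋀Lᵈ cs∈ ⟧ᵈ ∷ ⋀L cs ∷ []))
  (⟦¬⋀Lᵈ⟧ cs∈)

¬ᵖ : Prime → List Prime
¬ᵖ (prime ψ ψ′ ψs ψ∈ ψ′∈ ψs∈) =
  prime (¬' ψ) ⊤' [] (negL ψ∈) (atomL top) [] ∷
  prime ⊤' ⊤' (¬' ψ′ ∷ []) (atomL top) (atomL top) (negL ψ′∈ ∷ []) ∷
  ¬⋀Lᵈ ψs∈

⟦¬ᵖ⟧ : ∀ p → ⊢ ⟦ ¬ᵖ p ⟧ᵈ ⇔ ¬' ⟦ p ⟧ᵖ
⟦¬ᵖ⟧ (prime ψ ψ′ ψs _ _ ψs∈) = mp₃ (tautology
  (#ₛ 1 ⇒ₛ (#ₛ 2 ⇔ₛ #ₛ 3) ⇒ₛ (#ₛ 4 ⇔ₛ ¬ₛ #ₛ 5) ⇒ₛ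
   ((¬ₛ #ₛ 0 ∧ₛ (#ₛ 1 ∧ₛ ⊤ₛ)) ∨ₛ ((⊤ₛ ∧ₛ (#ₛ 1 ∧ₛ (¬ₛ #ₛ 2 ∧ₛ ⊤ₛ))) ∨ₛ #ₛ 4) ⇔ₛ
    ¬ₛ (#ₛ 0 ∧ₛ (#ₛ 3 ∧ₛ #ₛ 5))))
  (ψ ∷ K ⊤' ∷ K ¬' ¬' ψ′ ∷ K ψ′ ∷ ⟦ ¬⋀Lᵈ ψs∈ ⟧ᵈ ∷ ⋀L ψs ∷ []))
  ⊢K⊤ (K.cong ¬¬-equiv) (⟦¬⋀Lᵈ⟧ ψs∈)

¬ᵈ : List Prime → List Prime
¬ᵈ []       = atomᵖ top ∷ []
¬ᵈ (p ∷ ps) = ¬ᵖ p ∧ᵈ ¬ᵈ ps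

⟦¬ᵈ⟧ : ∀ ps → ⊢ ⟦ ¬ᵈ ps ⟧ᵈ ⇔ ¬' ⟦ ps ⟧ᵈ
⟦¬ᵈ⟧ [] = ⇔-trans (∨-cong (⟦atomᵖ⟧ top) ⇔-refl) (tautology (⊤ₛ ∨ₛ ⊥ₛ ⇔ₛ ¬ₛ ⊥ₛ) [])
⟦¬ᵈ⟧ (p ∷ ps) = begin-equality
  ⟦ ¬ᵖ p ∧ᵈ ¬ᵈ ps ⟧ᵈ               ≈⟨ ⟦∧ᵈ⟧ (¬ᵖ p) (¬ᵈ ps) ⟩
  ⟦ ¬ᵖ p ⟧ᵈ ∧' ⟦ ¬ᵈ ps ⟧ᵈ          ≈⟨ ∧-cong (⟦¬ᵖ⟧ p) (⟦¬ᵈ⟧ ps) ⟩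
  ¬' ⟦ p ⟧ᵖ ∧' ¬' ⟦ ps ⟧ᵈ          ≈⟨ ¬¬-equiv ⟨
  ¬' (⟦ p ⟧ᵖ ∨' ⟦ ps ⟧ᵈ)            ∎

module _ {M : Formula → Formula} (normal : Normal M) (f : Prime → Prime)
         (⟦f⟧ : ∀ p → ⊢ ⟦ f p ⟧ᵖ ⇔ Normal-Properties.◆ normal ⟦ p ⟧ᵖ) where
  open Normal-Properties normal

  ⟦¬ᵈmap¬ᵈ⟧ : ∀ ps → ⊢ ⟦ ps ⟧ᵈ ⇔ A → ⊢ ⟦ ¬ᵈ (map f (¬ᵈ ps)) ⟧ᵈ ⇔ M A
  ⟦¬ᵈmap¬ᵈ⟧ {A} ps ⟦ps⟧ = begin-equality
    ⟦ ¬ᵈ (map f (¬ᵈ ps)) ⟧ᵈ     ≈⟨ ⟦¬ᵈ⟧ (map f (¬ᵈ ps)) ⟩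
    ¬' ⟦ map f (¬ᵈ ps) ⟧ᵈ       ≈⟨ ¬-cong (⟦map⟧ ◆ ◆-∨ ◆-⊥ f ⟦f⟧ (¬ᵈ ps)) ⟩
    ¬' ◆ ⟦ ¬ᵈ ps ⟧ᵈ             ≈⟨ ¬-cong (◆-cong (⇔-trans (⟦¬ᵈ⟧ ps) (¬-cong ⟦ps⟧))) ⟩
    ¬' ◆ (¬' A)                 ≈⟨ ¬◆¬ ⟩
    M A                         ∎

conjoinL : Formula → List Formula → Formula
conjoinL = foldl (λ φ c → φ ∧' L c)

conjoinL-PNF : PNF A → All InL' cs → PNF (conjoinL A cs)
conjoinL-PNF A-pnf []         = A-pnf
conjoinL-PNF A-pnf (c∈ ∷ cs∈) = conjoinL-PNF (addL A-pnf c∈) cs∈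

conjoinL-sound : ∀ cs → ⊢ conjoinL A cs ⇔ A ∧' ⋀L cs
conjoinL-sound {A} []       = tautology (#ₛ 0 ⇔ₛ #ₛ 0 ∧ₛ ⊤ₛ) (A ∷ [])
conjoinL-sound {A} (c ∷ cs) = ⇔-trans (conjoinL-sound cs)
  (tautology ((#ₛ 0 ∧ₛ #ₛ 1) ∧ₛ #ₛ 2 ⇔ₛ #ₛ 0 ∧ₛ (#ₛ 1 ∧ₛ #ₛ 2)) (A ∷ L c ∷ ⋀L cs ∷ []))

pnf : Prime → Formula
pnf (prime ψ ψ′ ψs _ _ _) = conjoinL (ψ ∧' K ψ′) ψs

pnf-PNF : ∀ p → PNF (pnf p)
pnf-PNF (prime _ _ _ ψ∈ ψ′∈ ψs∈) = conjoinL-PNF (base ψ∈ ψ′∈) ψs∈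

pnf-sound : ∀ p → ⊢ pnf p ⇔ ⟦ p ⟧ᵖ
pnf-sound (prime ψ ψ′ ψs _ _ _) = ⇔-trans (conjoinL-sound ψs)
  (tautology ((#ₛ 0 ∧ₛ #ₛ 1) ∧ₛ #ₛ 2 ⇔ₛ #ₛ 0 ∧ₛ (#ₛ 1 ∧ₛ #ₛ 2)) (ψ ∷ K ψ′ ∷ ⋀L ψs ∷ []))

disjoin : Formula → List Prime → Formula
disjoin = foldl (λ φ p → φ ∨' pnf p)

disjoin-DNF : DNF A → ∀ ps → DNF (disjoin A ps)
disjoin-DNF A-dnf []       = A-dnf
disjoin-DNF A-dnf (p ∷ ps) = disjoin-DNF (orD A-dnf (pnf-PNF p)) ps

disjoin-sound : ∀ ps → ⊢ disjoin A ps ⇔ A ∨' ⟦ ps ⟧ᵈ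
disjoin-sound {A} []       = tautology (#ₛ 0 ⇔ₛ #ₛ 0 ∨ₛ ⊥ₛ) (A ∷ [])
disjoin-sound {A} (p ∷ ps) = ⇔-trans (disjoin-sound ps) (mp (tautology
  ((#ₛ 1 ⇔ₛ #ₛ 2) ⇒ₛ ((#ₛ 0 ∨ₛ #ₛ 1) ∨ₛ #ₛ 3 ⇔ₛ #ₛ 0 ∨ₛ (#ₛ 2 ∨ₛ #ₛ 3)))
  (A ∷ pnf p ∷ ⟦ p ⟧ᵖ ∷ ⟦ ps ⟧ᵈ ∷ []))
  (pnf-sound p))

-- The empty disjunction ⊥ is written as the prime ⊥ ∧ K⊤.
dnf : List Prime → Formula
dnf []       = pnf (atomᵖ bot)
dnf (p ∷ ps) = disjoin (pnf p) ps

dnf-DNF : ∀ ps → DNF (dnf ps)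
dnf-DNF []       = single (pnf-PNF (atomᵖ bot))
dnf-DNF (p ∷ ps) = disjoin-DNF (single (pnf-PNF p)) ps

dnf-sound : ∀ ps → ⊢ dnf ps ⇔ ⟦ ps ⟧ᵈ
dnf-sound []       = ⇔-trans (pnf-sound (atomᵖ bot)) (⟦atomᵖ⟧ bot)
dnf-sound (p ∷ ps) = ⇔-trans (disjoin-sound ps) (∨-cong (pnf-sound p) ⇔-refl)

nf : Formula → List Prime
nf (atom a) = atomᵖ a ∷ []
nf (φ ∧' ψ) = nf φ ∧ᵈ nf ψ
nf (¬' φ)   = ¬ᵈ (nf φ)
nf (□ φ)    = ¬ᵈ (map ◇ᵖ (¬ᵈ (nf φ)))
nf (K φ)    = ¬ᵈ (map Lᵖ (¬ᵈ (nf φ)))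

nf-sound : ∀ φ → ⊢ ⟦ nf φ ⟧ᵈ ⇔ φ
nf-sound (atom a) = ⇔-trans (tautology (#ₛ 0 ∨ₛ ⊥ₛ ⇔ₛ #ₛ 0) (⟦ atomᵖ a ⟧ᵖ ∷ [])) (⟦atomᵖ⟧ a)
nf-sound (φ ∧' ψ) = ⇔-trans (⟦∧ᵈ⟧ (nf φ) (nf ψ)) (∧-cong (nf-sound φ) (nf-sound ψ))
nf-sound (¬' φ)   = ⇔-trans (⟦¬ᵈ⟧ (nf φ)) (¬-cong (nf-sound φ))
nf-sound (□ φ)    = ⟦¬ᵈmap¬ᵈ⟧ □-normal ◇ᵖ ⟦◇ᵖ⟧ (nf φ) (nf-sound φ)
nf-sound (K φ)    = ⟦¬ᵈmap¬ᵈ⟧ K-normal Lᵖ ⟦Lᵖ⟧ (nf φ) (nf-sound φ)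

mainTheorem13 : Σ (Formula → Formula) (λ nf → (φ : Formula) → DNF (nf φ) × (⊢ (φ ⇔ nf φ)))
mainTheorem13 = (λ φ → dnf (nf φ)) , λ φ →
  dnf-DNF (nf φ) , ⇔-sym (⇔-trans (dnf-sound (nf φ)) (nf-sound φ))
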